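{- Let $\ell,m,a,b,k$ be integers with $\ell\le m$ and $a,b,k\ge1$. Put $d:=m-\ell+1$, $k_1:=k+a(1-\ell)+b(m+1)$ and $k_2:=k+b(1-\ell)+a(m+1)$. Then the number of tuples $(x_1,\dots,x_{a+b})$ of integers with $\ell\le x_i\le m$ for all $i$ satisfying $$\left|\sum_{i=1}^a x_i-\sum_{i=a+1}^{a+b}x_i\right|=k$$ equals $\tau_{a+b,k_1,d}+\tau_{a+b,k_2,d}$. In particular, such a solution exists when either (i) $a\ell-bm\le k\le am-b\ell$, or (ii) $b\ell-am\le k\le bm-a\ell$.
   Context: For an integer $k$ and positive integers $p,d$, $\tau_{p,k,d}:=\sum_{i=0}^{\lfloor (k-p)/d\rfloor}(-1)^i\binom{p}{i}\binom{k-id-1}{p-1}$, with the empty sum equal to $0$. -}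

module Defs where

open import Data.Nat as ℕ using (ℕ; zero; suc; _/_)
open import Data.Nat.Combinatorics using (_C_)
open import Data.Integer as ℤ using (ℤ; +_; -[1+_]; _+_; _-_; _*_; -_; _^_; ∣_∣; _≤_; _≤ᵇ_; 0ℤ; 1ℤ)
open import Data.List as L using (List; []; _∷_; upTo; map; concatMap; filterᵇ; foldr; length)
open import Data.Vec as V using (Vec; take; drop)
open import Data.Bool using (Bool; _∧_)
open import Data.Product using (_×_)

sumℤ : List ℤ → ℤ
sumℤ = foldr _+_ 0ℤ

vsum : ∀ {n} → Vec ℤ n → ℤ
vsum = V.foldr _ _+_ 0ℤ

-- τ_{p,k,d} = Σ_{i=0}^{⌊(k-p)/d⌋} (-1)^i C(p,i) C(k-id-1, p-1), empty sum (= 0) when k - p < 0.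
-- In the summation range k - i d - 1 ≥ p - 1 ≥ 0, so ∣_∣ is just the identity there.
-- The parameter d is a positive integer; the value at d = 0 is irrelevant (set to 0).
τ : ℕ → ℤ → ℕ → ℤ
τ p k zero = 0ℤ
τ p k (suc d') with k - + p
... | -[1+ _ ] = 0ℤ
... | + t = sumℤ (map term (upTo (suc (t / suc d'))))
  where
  term : ℕ → ℤ
  term i = ((- 1ℤ) ^ i) * (+ (p C i)) * (+ (∣ k - + (i ℕ.* suc d') - 1ℤ ∣ C (p ℕ.∸ 1)))

-- the integers ℓ, ℓ+1, …, m (empty if m < ℓ)
range : ℤ → ℤ → List ℤ
range ℓ m = filterᵇ (λ x → x ≤ᵇ m) (map (λ i → ℓ + + i) (upTo ∣ m - ℓ + 1ℤ ∣))

tuples : ℤ → ℤ → (n : ℕ) → List (Vec ℤ n)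
tuples ℓ m zero = V.[] ∷ []
tuples ℓ m (suc n) = concatMap (λ x → map (x V.∷_) (tuples ℓ m n)) (range ℓ m)

solvesᵇ : (a b : ℕ) → ℤ → Vec ℤ (a ℕ.+ b) → Bool
solvesᵇ a b k xs = let s = vsum (take a xs) - vsum (drop a xs) in (+ ∣ s ∣ ≤ᵇ k) ∧ (k ≤ᵇ + ∣ s ∣)

count : (ℓ m : ℤ) (a b : ℕ) (k : ℤ) → ℕ
count ℓ m a b k = length (filterᵇ (solvesᵇ a b k) (tuples ℓ m (a ℕ.+ b)))

-- Send the first a coordinates through x ↦ x + 1 - ℓ and the last b through x ↦ m + 1 - x. Both
-- maps take [ℓ, m] onto [1, d], and a tuple with signed sum s becomes a composition of
-- s + a(1 - ℓ) + b(m + 1) into a + b parts from [1, d]. Inclusion–exclusion (hockey stick plus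
-- Pascal's rule) shows that τ_{p,K,d} counts exactly such compositions of K. Since k ≥ 1, the
-- condition |s| = k splits into the disjoint cases s = k, which gives k₁, and s = -k, which
-- gives k₂ after the symmetry K ↦ p(d + 1) - K of bounded compositions. For existence, pick
-- block sums inside the attainable ranges and fill each block greedily.

module Submission where

open import Defs
open import Data.Bool using (Bool; true; false; T; _∧_; if_then_else_)
open import Data.Bool.Properties using (T-∧)
open import Data.Empty using (⊥-elim)
open import Data.Fin using (Fin)
open import Data.Integer using (ℤ; +_; -[1+_]; _+_; _-_; _*_; -_; _^_; ∣_∣; _⊖_; _≤_; +≤+; -<+; _≤ᵇ_; 0ℤ; 1ℤ; -1ℤ)
open import Data.Integer.Properties
open import Data.Integer.Tactic.RingSolver using (solve-∀)
open import Algebra.Properties.CommutativeSemigroup +-commutativeSemigroup using (interchange)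
open import Algebra.Properties.Ring +-*-ring using (x[y-z]≈xy-xz; [y-z]x≈yx-zx)
open import Data.List as List using (List; []; _∷_; map; applyUpTo; concatMap; filterᵇ; length; upTo)
open import Data.List.Properties using (map-upTo; map-applyUpTo; map-++; map-cong; map-∘; filter-all)
open import Data.List.Relation.Unary.All.Properties using (applyUpTo⁺₁)
open import Data.Nat as ℕ using (ℕ; zero; suc)
import Data.Nat.Properties as ℕ
open import Data.Nat.DivMod using (_/_; m/n*n≤m; m*n/n≡m; /-monoˡ-≤)
open import Data.Nat.Combinatorics using (_C_; nCk+nC[k+1]≡[n+1]C[k+1]; k>n⇒nCk≡0)
open import Data.Product using (_×_; _,_; ∃; ∃₂; proj₂)
open import Data.Sum using (_⊎_; inj₁; inj₂)
open import Data.Unit using (tt)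
open import Data.Vec using (Vec; []; _∷_; lookup; take; drop; _++_; splitAt)
open import Data.Vec.Properties using (++-injective)
open import Data.Vec.Relation.Unary.All using (All; []; _∷_)
open import Data.Vec.Relation.Unary.All.Properties using (lookup⁺; ++⁺)
open import Function using (_∘_; Equivalence)
open import Relation.Nullary using (yes; no)
open import Relation.Nullary.Decidable using (T?)
open import Relation.Binary.PropositionalEquality
open ≡-Reasoning

-- Finite sums

∑ : ℕ → (ℕ → ℤ) → ℤ
∑ n f = sumℤ (applyUpTo f n)

infix 9 ∑
syntax ∑ n (λ i → e) = ∑[ i < n ] e

∑-cong : ∀ n {f g : ℕ → ℤ} → (∀ i → f i ≡ g i) → ∑ n f ≡ ∑ n g
∑-cong zero    f≗g = refl
∑-cong (suc n) f≗g = cong₂ _+_ (f≗g 0) (∑-cong n (f≗g ∘ suc))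

∑-cong-< : ∀ n {f g : ℕ → ℤ} → (∀ {i} → i ℕ.< n → f i ≡ g i) → ∑ n f ≡ ∑ n g
∑-cong-< zero    f≗g = refl
∑-cong-< (suc n) f≗g = cong₂ _+_ (f≗g ℕ.z<s) (∑-cong-< n (f≗g ∘ ℕ.s<s))

∑-zero : ∀ n → ∑[ i < n ] 0ℤ ≡ 0ℤ
∑-zero zero    = refl
∑-zero (suc n) = trans (+-identityˡ _) (∑-zero n)

∑-distrib-+ : ∀ n (f g : ℕ → ℤ) → ∑[ i < n ] (f i + g i) ≡ ∑ n f + ∑ n g
∑-distrib-+ zero    f g = refl
∑-distrib-+ (suc n) f g = begin
  f 0 + g 0 + ∑[ i < n ] (f (suc i) + g (suc i))  ≡⟨ cong (_+_ (f 0 + g 0)) (∑-distrib-+ n (f ∘ suc) (g ∘ suc)) ⟩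
  f 0 + g 0 + (∑ n (f ∘ suc) + ∑ n (g ∘ suc))      ≡⟨ interchange (f 0) (g 0) (∑ n (f ∘ suc)) (∑ n (g ∘ suc)) ⟩
  f 0 + ∑ n (f ∘ suc) + (g 0 + ∑ n (g ∘ suc))      ∎

∑-neg : ∀ n (f : ℕ → ℤ) → ∑[ i < n ] (- f i) ≡ - ∑ n f
∑-neg zero    f = refl
∑-neg (suc n) f = trans (cong (_+_ (- f 0)) (∑-neg n (f ∘ suc))) (sym (neg-distrib-+ (f 0) _))

∑-distrib-- : ∀ n (f g : ℕ → ℤ) → ∑[ i < n ] (f i - g i) ≡ ∑ n f - ∑ n g
∑-distrib-- n f g = trans (∑-distrib-+ n f (-_ ∘ g)) (cong (_+_ (∑ n f)) (∑-neg n g))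

∑-distribˡ-* : ∀ n c (f : ℕ → ℤ) → ∑[ i < n ] (c * f i) ≡ c * ∑ n f
∑-distribˡ-* zero    c f = sym (*-zeroʳ c)
∑-distribˡ-* (suc n) c f = trans (cong (_+_ (c * f 0)) (∑-distribˡ-* n c (f ∘ suc))) (sym (*-distribˡ-+ c (f 0) _))

∑-last : ∀ n (f : ℕ → ℤ) → ∑ (suc n) f ≡ ∑ n f + f n
∑-last zero    f = +-comm (f 0) 0ℤ
∑-last (suc n) f = trans (cong (_+_ (f 0)) (∑-last n (f ∘ suc))) (sym (+-assoc (f 0) _ _))

∑-comm : ∀ m n (f : ℕ → ℕ → ℤ) → ∑[ i < m ] ∑[ j < n ] f i j ≡ ∑[ j < n ] ∑[ i < m ] f i j
∑-comm zero    n f = sym (∑-zero n)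
∑-comm (suc m) n f = begin
  ∑[ j < n ] f 0 j + ∑[ i < m ] ∑[ j < n ] f (suc i) j  ≡⟨ cong (_+_ (∑ n (f 0))) (∑-comm m n (f ∘ suc)) ⟩
  ∑[ j < n ] f 0 j + ∑[ j < n ] ∑[ i < m ] f (suc i) j  ≡⟨ ∑-distrib-+ n (f 0) _ ⟨
  ∑[ j < n ] ∑[ i < suc m ] f i j                       ∎

∑-reverse : ∀ n (f : ℤ → ℤ) → ∑[ j < n ] f (+ j) ≡ ∑[ j < n ] f (+ n - 1ℤ - + j)
∑-reverse zero    f = refl
∑-reverse (suc n) f = begin
  f 0ℤ + ∑[ j < n ] f (1ℤ + + j)                         ≡⟨ cong (_+_ (f 0ℤ)) (∑-reverse n (f ∘ _+_ 1ℤ)) ⟩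
  f 0ℤ + ∑[ j < n ] f (1ℤ + (+ n - 1ℤ - + j))            ≡⟨ +-comm (f 0ℤ) _ ⟩
  ∑[ j < n ] f (1ℤ + (+ n - 1ℤ - + j)) + f 0ℤ
    ≡⟨ cong₂ _+_ (∑-cong n λ j → cong f (shift (+ n) (+ j))) (cong f (top (+ n))) ⟩
  ∑[ j < n ] f (+ suc n - 1ℤ - + j) + f (+ suc n - 1ℤ - + n)  ≡⟨ ∑-last n _ ⟨
  ∑[ j < suc n ] f (+ suc n - 1ℤ - + j)                 ∎
  where
  shift : ∀ x y → 1ℤ + (x - 1ℤ - y) ≡ 1ℤ + x - 1ℤ - y
  shift = solve-∀
  top : ∀ x → 0ℤ ≡ 1ℤ + x - 1ℤ - x
  top = solve-∀

∑-extend : ∀ m n (f : ℕ → ℤ) → (∀ i → m ℕ.≤ i → f i ≡ 0ℤ) → ∑ (m ℕ.+ n) f ≡ ∑ m f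
∑-extend zero    n f f≡0 = trans (∑-cong n λ i → f≡0 i ℕ.z≤n) (∑-zero n)
∑-extend (suc m) n f f≡0 = cong (_+_ (f 0)) (∑-extend m n (f ∘ suc) λ i → f≡0 (suc i) ∘ ℕ.s≤s)

∑-resize : ∀ m n (f : ℕ → ℤ) → (∀ i → m ℕ.≤ i → f i ≡ 0ℤ) → (∀ i → n ℕ.≤ i → f i ≡ 0ℤ) →
           ∑ m f ≡ ∑ n f
∑-resize m n f m≤⇒0 n≤⇒0 = begin
  ∑ m f            ≡⟨ ∑-extend m n f m≤⇒0 ⟨
  ∑ (m ℕ.+ n) f    ≡⟨ cong (λ k → ∑ k f) (ℕ.+-comm m n) ⟩
  ∑ (n ℕ.+ m) f    ≡⟨ ∑-extend n m f n≤⇒0 ⟩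
  ∑ n f            ∎

∑-telescope : ∀ d (g : ℤ → ℤ) M → ∑[ j < d ] (g (1ℤ + (M - + j)) - g (M - + j)) ≡ g (1ℤ + M) - g (1ℤ + M - + d)
∑-telescope zero    g M = begin
  0ℤ                          ≡⟨ +-inverseʳ (g (1ℤ + M)) ⟨
  g (1ℤ + M) - g (1ℤ + M)      ≡⟨ cong (λ x → g (1ℤ + M) - g x) (+-identityʳ (1ℤ + M)) ⟨
  g (1ℤ + M) - g (1ℤ + M - 0ℤ) ∎
∑-telescope (suc d) g M = begin
  ∑[ j < suc d ] (g (1ℤ + (M - + j)) - g (M - + j))
    ≡⟨ ∑-last d _ ⟩
  ∑[ j < d ] (g (1ℤ + (M - + j)) - g (M - + j)) + (g (1ℤ + (M - + d)) - g (M - + d))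
    ≡⟨ cong₂ (λ x y → x + (g y - g (M - + d))) (∑-telescope d g M) (sym (+-assoc 1ℤ M (- + d))) ⟩
  g (1ℤ + M) - g (1ℤ + M - + d) + (g (1ℤ + M - + d) - g (M - + d))
    ≡⟨ cong (λ x → g (1ℤ + M) - g (1ℤ + M - + d) + (g (1ℤ + M - + d) - g x)) (step M (+ d)) ⟩
  g (1ℤ + M) - g (1ℤ + M - + d) + (g (1ℤ + M - + d) - g (1ℤ + M - + suc d))
    ≡⟨ chain (g (1ℤ + M)) (g (1ℤ + M - + d)) _ ⟩
  g (1ℤ + M) - g (1ℤ + M - + suc d) ∎
  where
  step : ∀ M d → M - d ≡ 1ℤ + M - (1ℤ + d)
  step = solve-∀
  chain : ∀ a b c → a - b + (b - c) ≡ a - c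
  chain = solve-∀

sumℤ-++ : ∀ xs ys → sumℤ (xs List.++ ys) ≡ sumℤ xs + sumℤ ys
sumℤ-++ []       ys = sym (+-identityˡ (sumℤ ys))
sumℤ-++ (x ∷ xs) ys = trans (cong (_+_ x) (sumℤ-++ xs ys)) (sym (+-assoc x (sumℤ xs) (sumℤ ys)))

sumℤ-map-concatMap : ∀ {A B : Set} (f : B → ℤ) (g : A → List B) xs →
  sumℤ (map f (concatMap g xs)) ≡ sumℤ (map (λ x → sumℤ (map f (g x))) xs)
sumℤ-map-concatMap f g []       = refl
sumℤ-map-concatMap f g (x ∷ xs) = begin
  sumℤ (map f (g x List.++ concatMap g xs))           ≡⟨ cong sumℤ (map-++ f (g x) (concatMap g xs)) ⟩
  sumℤ (map f (g x) List.++ map f (concatMap g xs))   ≡⟨ sumℤ-++ (map f (g x)) _ ⟩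
  sumℤ (map f (g x)) + sumℤ (map f (concatMap g xs))  ≡⟨ cong (_+_ (sumℤ (map f (g x)))) (sumℤ-map-concatMap f g xs) ⟩
  sumℤ (map f (g x)) + sumℤ (map (λ x → sumℤ (map f (g x))) xs) ∎

sumℤ-map-+ : ∀ {A : Set} (f g : A → ℤ) xs → sumℤ (map (λ x → f x + g x) xs) ≡ sumℤ (map f xs) + sumℤ (map g xs)
sumℤ-map-+ f g []       = refl
sumℤ-map-+ f g (x ∷ xs) = begin
  f x + g x + sumℤ (map (λ x → f x + g x) xs)      ≡⟨ cong (_+_ (f x + g x)) (sumℤ-map-+ f g xs) ⟩
  f x + g x + (sumℤ (map f xs) + sumℤ (map g xs))  ≡⟨ interchange (f x) (g x) (sumℤ (map f xs)) (sumℤ (map g xs)) ⟩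
  f x + sumℤ (map f xs) + (g x + sumℤ (map g xs))  ∎

length-filterᵇ : ∀ {A : Set} (P : A → Bool) xs → + length (filterᵇ P xs) ≡ sumℤ (map (λ x → if P x then 1ℤ else 0ℤ) xs)
length-filterᵇ P []       = refl
length-filterᵇ P (x ∷ xs) with P x
... | true  = cong (_+_ 1ℤ) (length-filterᵇ P xs)
... | false = trans (length-filterᵇ P xs) (sym (+-identityˡ _))

≤-by-slack : ∀ {a b c e} → a ≤ b → e - c ≡ b - a → c ≤ e
≤-by-slack a≤b e-c≡b-a = 0≤i-j⇒j≤i (subst (0ℤ ≤_) (sym e-c≡b-a) (i≤j⇒0≤j-i a≤b))

i≤j⇒∃[k]j≡i+k : ∀ {i j} → i ≤ j → ∃ λ k → j ≡ i + + k
i≤j⇒∃[k]j≡i+k {i} {j} i≤j = ∣ j - i ∣ , trans (split j i) (cong (_+_ i) (sym (0≤i⇒+∣i∣≡i (i≤j⇒0≤j-i i≤j))))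
  where
  split : ∀ j i → j ≡ i + (j - i)
  split = solve-∀

*-vanishʳ : ∀ a {b} → b ≡ 0ℤ → a * b ≡ 0ℤ
*-vanishʳ a refl = *-zeroʳ a

m/n<o⇒m<o*n : ∀ {m n o} .{{_ : ℕ.NonZero n}} → m / n ℕ.< o → m ℕ.< o ℕ.* n
m/n<o⇒m<o*n {m} {n} {o} m/n<o = ℕ.≰⇒> λ o*n≤m →
  ℕ.<⇒≱ m/n<o (subst (ℕ._≤ m / n) (m*n/n≡m o n) (/-monoˡ-≤ n o*n≤m))

o≤m/n⇒o*n≤m : ∀ {m n o} .{{_ : ℕ.NonZero n}} → o ℕ.≤ m / n → o ℕ.* n ℕ.≤ m
o≤m/n⇒o*n≤m {m} {n} o≤m/n = ℕ.≤-trans (ℕ.*-monoˡ-≤ n o≤m/n) (m/n*n≤m m n)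

-- Compositions

δ : ℤ → ℤ
δ (+ zero)  = 1ℤ
δ (+ suc _) = 0ℤ
δ -[1+ _ ]  = 0ℤ

δ-neg : ∀ x → δ (- x) ≡ δ x
δ-neg (+ zero)  = refl
δ-neg (+ suc _) = refl
δ-neg -[1+ _ ]  = refl

δ-≢0 : ∀ {x} → x ≢ 0ℤ → δ x ≡ 0ℤ
δ-≢0 {+ zero}   x≢0 = ⊥-elim (x≢0 refl)
δ-≢0 {+ suc _}  _   = refl
δ-≢0 { -[1+ _ ]} _  = refl

compositions : ℤ → ℕ → ℤ
compositions M         zero    = δ M
compositions (+ zero)  (suc r) = 0ℤ
compositions (+ suc n) (suc r) = + (n C r)
compositions -[1+ _ ]  (suc r) = 0ℤ

compositions-pascal : ∀ M r → compositions (1ℤ + M) (suc r) - compositions M (suc r) ≡ compositions M r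
compositions-pascal (+ zero)     zero    = refl
compositions-pascal (+ suc n)    zero    = refl
compositions-pascal (+ zero)     (suc r) = refl
compositions-pascal (+ suc n)    (suc r) = begin
  + (suc n C suc r) - + (n C suc r)           ≡⟨ cong (λ x → + x - + (n C suc r)) (nCk+nC[k+1]≡[n+1]C[k+1] n r) ⟨
  + (n C r) + + (n C suc r) - + (n C suc r)   ≡⟨ cancel (+ (n C r)) (+ (n C suc r)) ⟩
  + (n C r)                                   ∎
  where
  cancel : ∀ x y → x + y - y ≡ x
  cancel = solve-∀
compositions-pascal -[1+ zero ]  zero    = refl
compositions-pascal -[1+ suc _ ] zero    = refl
compositions-pascal -[1+ zero ]  (suc r) = refl
compositions-pascal -[1+ suc _ ] (suc r) = refl

hockey-stick : ∀ d M r → ∑[ j < d ] compositions (M - + j) r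
                       ≡ compositions (1ℤ + M) (suc r) - compositions (1ℤ + M - + d) (suc r)
hockey-stick d M r = begin
  ∑[ j < d ] compositions (M - + j) r
    ≡⟨ ∑-cong d (λ j → compositions-pascal (M - + j) r) ⟨
  ∑[ j < d ] (compositions (1ℤ + (M - + j)) (suc r) - compositions (M - + j) (suc r))
    ≡⟨ ∑-telescope d (λ x → compositions x (suc r)) M ⟩
  compositions (1ℤ + M) (suc r) - compositions (1ℤ + M - + d) (suc r) ∎

compositions-vanish : ∀ {M} q → M ≤ + q → compositions M (suc q) ≡ 0ℤ
compositions-vanish {+ zero}    q _         = refl
compositions-vanish {+ suc n}   q (+≤+ n<q) = cong +_ (k>n⇒nCk≡0 n<q)
compositions-vanish { -[1+ _ ]} q _         = refl

compositions≡binomial : ∀ {M} q → 1ℤ ≤ M → compositions M (suc q) ≡ + (∣ M - 1ℤ ∣ C q)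
compositions≡binomial {+ zero}  q (+≤+ ())
compositions≡binomial {+ suc n} q _ = refl

-- Compositions with bounded parts

boundedCompositions : ℕ → ℕ → ℤ → ℤ
boundedCompositions d zero    K = δ K
boundedCompositions d (suc p) K = ∑[ j < d ] boundedCompositions d p (K - + suc j)

signedBinomial : ℕ → ℕ → ℤ
signedBinomial p i = -1ℤ ^ i * + (p C i)

signedBinomial-pascal : ∀ p i → signedBinomial (suc p) (suc i) ≡ signedBinomial p (suc i) - signedBinomial p i
signedBinomial-pascal p i = begin
  -1ℤ * -1ℤ ^ i * + (suc p C suc i)              ≡⟨ cong (λ x → -1ℤ * -1ℤ ^ i * + x) (nCk+nC[k+1]≡[n+1]C[k+1] p i) ⟨
  -1ℤ * -1ℤ ^ i * (+ (p C i) + + (p C suc i))    ≡⟨ expand (-1ℤ ^ i) (+ (p C i)) (+ (p C suc i)) ⟩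
  -1ℤ * -1ℤ ^ i * + (p C suc i) - -1ℤ ^ i * + (p C i) ∎
  where
  expand : ∀ s x y → -1ℤ * s * (x + y) ≡ -1ℤ * s * y - s * x
  expand = solve-∀

signedBinomial-vanish : ∀ p {i} → p ℕ.< i → signedBinomial p i ≡ 0ℤ
signedBinomial-vanish p {i} p<i = trans (cong (λ x → -1ℤ ^ i * + x) (k>n⇒nCk≡0 p<i)) (*-zeroʳ (-1ℤ ^ i))

∑-signedBinomial-suc : ∀ p (h : ℕ → ℤ) → ∑[ i < suc (suc p) ] (signedBinomial (suc p) i * h i)
                                      ≡ ∑[ i < suc p ] (signedBinomial p i * (h i - h (suc i)))
∑-signedBinomial-suc p h = begin
  ∑[ i < suc (suc p) ] (signedBinomial (suc p) i * h i)
    ≡⟨ cong (_+_ (1ℤ * h 0)) pascal ⟩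
  1ℤ * h 0 + (∑[ i < suc p ] (c (suc i) * h (suc i)) - ∑[ i < suc p ] (c i * h (suc i)))
    ≡⟨ +-assoc (1ℤ * h 0) _ _ ⟨
  ∑[ i < suc (suc p) ] (c i * h i) - ∑[ i < suc p ] (c i * h (suc i))
    ≡⟨ cong (_- ∑[ i < suc p ] (c i * h (suc i))) drop-top ⟩
  ∑[ i < suc p ] (c i * h i) - ∑[ i < suc p ] (c i * h (suc i))
    ≡⟨ ∑-distrib-- (suc p) (λ i → c i * h i) (λ i → c i * h (suc i)) ⟨
  ∑[ i < suc p ] (c i * h i - c i * h (suc i))
    ≡⟨ ∑-cong (suc p) (λ i → x[y-z]≈xy-xz (c i) (h i) (h (suc i))) ⟨
  ∑[ i < suc p ] (c i * (h i - h (suc i))) ∎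
  where
  c : ℕ → ℤ
  c = signedBinomial p
  pascal : ∑[ i < suc p ] (signedBinomial (suc p) (suc i) * h (suc i))
         ≡ ∑[ i < suc p ] (c (suc i) * h (suc i)) - ∑[ i < suc p ] (c i * h (suc i))
  pascal = begin
    ∑[ i < suc p ] (signedBinomial (suc p) (suc i) * h (suc i))
      ≡⟨ ∑-cong (suc p) (λ i → cong (_* h (suc i)) (signedBinomial-pascal p i)) ⟩
    ∑[ i < suc p ] ((c (suc i) - c i) * h (suc i))
      ≡⟨ ∑-cong (suc p) (λ i → [y-z]x≈yx-zx (h (suc i)) (c (suc i)) (c i)) ⟩
    ∑[ i < suc p ] (c (suc i) * h (suc i) - c i * h (suc i))
      ≡⟨ ∑-distrib-- (suc p) (λ i → c (suc i) * h (suc i)) (λ i → c i * h (suc i)) ⟩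
    ∑[ i < suc p ] (c (suc i) * h (suc i)) - ∑[ i < suc p ] (c i * h (suc i)) ∎
  drop-top : ∑[ i < suc (suc p) ] (c i * h i) ≡ ∑[ i < suc p ] (c i * h i)
  drop-top = begin
    ∑[ i < suc (suc p) ] (c i * h i)
      ≡⟨ ∑-last (suc p) (λ i → c i * h i) ⟩
    ∑[ i < suc p ] (c i * h i) + c (suc p) * h (suc p)
      ≡⟨ cong (λ x → ∑[ i < suc p ] (c i * h i) + x * h (suc p)) (signedBinomial-vanish p ℕ.≤-refl) ⟩
    ∑[ i < suc p ] (c i * h i) + 0ℤ
      ≡⟨ +-identityʳ _ ⟩
    ∑[ i < suc p ] (c i * h i) ∎

boundedCompositions-inclusionExclusion : ∀ d p K →
  boundedCompositions d p K ≡ ∑[ i < suc p ] (signedBinomial p i * compositions (K - + (i ℕ.* d)) p)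
boundedCompositions-inclusionExclusion d zero K = begin
  δ K                               ≡⟨ cong δ (+-identityʳ K) ⟨
  δ (K - 0ℤ)                        ≡⟨ *-identityˡ (δ (K - 0ℤ)) ⟨
  1ℤ * δ (K - 0ℤ)                   ≡⟨ +-identityʳ (1ℤ * δ (K - 0ℤ)) ⟨
  1ℤ * δ (K - 0ℤ) + 0ℤ              ∎
boundedCompositions-inclusionExclusion d (suc p) K = begin
  ∑[ j < d ] boundedCompositions d p (K - + suc j)
    ≡⟨ ∑-cong d (λ j → boundedCompositions-inclusionExclusion d p (K - + suc j)) ⟩
  ∑[ j < d ] ∑[ i < suc p ] (signedBinomial p i * compositions (K - + suc j - + (i ℕ.* d)) p)
    ≡⟨ ∑-comm d (suc p) (λ j i → signedBinomial p i * compositions (K - + suc j - + (i ℕ.* d)) p) ⟩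
  ∑[ i < suc p ] ∑[ j < d ] (signedBinomial p i * compositions (K - + suc j - + (i ℕ.* d)) p)
    ≡⟨ ∑-cong (suc p) (λ i → trans (∑-distribˡ-* d (signedBinomial p i) _) (cong (signedBinomial p i *_) (layer i))) ⟩
  ∑[ i < suc p ] (signedBinomial p i * (h i - h (suc i)))
    ≡⟨ ∑-signedBinomial-suc p h ⟨
  ∑[ i < suc (suc p) ] (signedBinomial (suc p) i * h i) ∎
  where
  h : ℕ → ℤ
  h i = compositions (K - + (i ℕ.* d)) (suc p)
  layer : ∀ i → ∑[ j < d ] compositions (K - + suc j - + (i ℕ.* d)) p ≡ h i - h (suc i)
  layer i = begin
    ∑[ j < d ] compositions (K - + suc j - + (i ℕ.* d)) p
      ≡⟨ ∑-cong d (λ j → cong (λ x → compositions x p) (regroup K (+ j) (+ (i ℕ.* d)))) ⟩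
    ∑[ j < d ] compositions (M - + j) p
      ≡⟨ hockey-stick d M p ⟩
    compositions (1ℤ + M) (suc p) - compositions (1ℤ + M - + d) (suc p)
      ≡⟨ cong₂ (λ x y → compositions x (suc p) - compositions y (suc p)) (top K (+ (i ℕ.* d))) (bottom K (+ (i ℕ.* d)) (+ d)) ⟩
    h i - h (suc i) ∎
    where
    M = K - + (i ℕ.* d) - 1ℤ
    regroup : ∀ K j x → K - (1ℤ + j) - x ≡ K - x - 1ℤ - j
    regroup = solve-∀
    top : ∀ K x → 1ℤ + (K - x - 1ℤ) ≡ K - x
    top = solve-∀
    bottom : ∀ K x y → 1ℤ + (K - x - 1ℤ) - y ≡ K - (y + x)
    bottom = solve-∀

boundedCompositions-reflect : ∀ d p K → boundedCompositions d p K ≡ boundedCompositions d p (+ p * (+ d + 1ℤ) - K)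
boundedCompositions-reflect d zero K = trans (sym (δ-neg K)) (cong δ (negate K (+ d + 1ℤ)))
  where
  negate : ∀ K x → - K ≡ 0ℤ * x - K
  negate = solve-∀
boundedCompositions-reflect d (suc p) K = begin
  ∑[ j < d ] boundedCompositions d p (K - + suc j)
    ≡⟨ ∑-cong d (λ j → trans (boundedCompositions-reflect d p (K - + suc j))
                             (cong (boundedCompositions d p) (reflect-shift (+ p) (+ d) K (+ j)))) ⟩
  ∑[ j < d ] f (+ j)
    ≡⟨ ∑-reverse d f ⟩
  ∑[ j < d ] f (+ d - 1ℤ - + j)
    ≡⟨ ∑-cong d (λ j → cong (boundedCompositions d p) (reflect-reverse (+ p) (+ d) K (+ j))) ⟩
  ∑[ j < d ] boundedCompositions d p (+ suc p * (+ d + 1ℤ) - K - + suc j) ∎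
  where
  f : ℤ → ℤ
  f x = boundedCompositions d p (+ p * (+ d + 1ℤ) - K + 1ℤ + x)
  reflect-shift : ∀ p d K j → p * (d + 1ℤ) - (K - (1ℤ + j)) ≡ p * (d + 1ℤ) - K + 1ℤ + j
  reflect-shift = solve-∀
  reflect-reverse : ∀ p d K j → p * (d + 1ℤ) - K + 1ℤ + (d - 1ℤ - j) ≡ (1ℤ + p) * (d + 1ℤ) - K - (1ℤ + j)
  reflect-reverse = solve-∀

K-x≤q : ∀ q K {r x} → K - + suc q ≡ r → 1ℤ + r ≤ x → K - x ≤ + q
K-x≤q q K {r} {x} K-p≡r 1+r≤x = ≤-by-slack 1+r≤x (begin
  + q - (K - x)                ≡⟨ regroup (+ q) K x ⟩
  x - (1ℤ + (K - (1ℤ + + q)))  ≡⟨ cong (λ y → x - (1ℤ + y)) K-p≡r ⟩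
  x - (1ℤ + r)                 ∎)
  where
  regroup : ∀ q K x → q - (K - x) ≡ x - (1ℤ + (K - (1ℤ + q)))
  regroup = solve-∀

1≤K-x : ∀ q K {r x} → K - + suc q ≡ r → x ≤ r → 1ℤ ≤ K - x
1≤K-x q K {r} {x} K-p≡r x≤r = ≤-trans (+≤+ (ℕ.s≤s ℕ.z≤n)) (≤-by-slack x≤r (begin
  K - x - (1ℤ + + q)  ≡⟨ regroup (+ q) K x ⟩
  K - (1ℤ + + q) - x  ≡⟨ cong (_- x) K-p≡r ⟩
  r - x               ∎))
  where
  regroup : ∀ q K x → K - x - (1ℤ + q) ≡ K - (1ℤ + q) - x
  regroup = solve-∀

-- τ sums only up to ⌊(K - p)/d⌋: the terms beyond vanish because compositions (K - i d) p = 0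
-- once i d > K - p, and the terms with i > p because C(p, i) = 0.
τ≡inclusionExclusion : ∀ q d K →
  τ (suc q) K (suc d) ≡ ∑[ i < suc (suc q) ] (signedBinomial (suc q) i * compositions (K - + (i ℕ.* suc d)) (suc q))
τ≡inclusionExclusion q d K with K - + suc q in K-p≡r
... | -[1+ t ] = sym (trans (∑-cong (suc (suc q)) λ i →
                             *-vanishʳ (signedBinomial (suc q) i) (compositions-vanish q (K-x≤q q K K-p≡r (r<x (i ℕ.* suc d)))))
                           (∑-zero (suc (suc q))))
  where
  r<x : ∀ x → 1ℤ + -[1+ t ] ≤ + x
  r<x x = i<j⇒suc[i]≤j {i = -[1+ t ]} -<+
... | + t = begin
  sumℤ (map term (upTo (suc (t / suc d))))
    ≡⟨ cong sumℤ (map-upTo term (suc (t / suc d))) ⟩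
  ∑ (suc (t / suc d)) term
    ≡⟨ ∑-cong-< (suc (t / suc d)) (λ {i} i≤t/D → cong (signedBinomial (suc q) i *_)
         (sym (compositions≡binomial q (1≤K-x q K K-p≡r (+≤+ (o≤m/n⇒o*n≤m (ℕ.s≤s⁻¹ i≤t/D))))))) ⟩
  ∑ (suc (t / suc d)) g
    ≡⟨ ∑-resize (suc (t / suc d)) (suc (suc q)) g
         (λ i t/D<i → *-vanishʳ (signedBinomial (suc q) i) (compositions-vanish q (K-x≤q q K K-p≡r (+≤+ (m/n<o⇒m<o*n t/D<i)))))
         (λ i p<i → cong (_* compositions (K - + (i ℕ.* suc d)) (suc q)) (signedBinomial-vanish (suc q) p<i)) ⟩
  ∑ (suc (suc q)) g ∎
  where
  term g : ℕ → ℤ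
  term i = -1ℤ ^ i * + (suc q C i) * + (∣ K - + (i ℕ.* suc d) - 1ℤ ∣ C q)
  g i = signedBinomial (suc q) i * compositions (K - + (i ℕ.* suc d)) (suc q)

τ≡boundedCompositions : ∀ q d K → τ (suc q) K (suc d) ≡ boundedCompositions (suc d) (suc q) K
τ≡boundedCompositions q d K =
  trans (τ≡inclusionExclusion q d K) (sym (boundedCompositions-inclusionExclusion (suc d) (suc q) K))

-- Counting tuples in a box

≤ᵇ-antisym : ∀ {i j} → T ((i ≤ᵇ j) ∧ (j ≤ᵇ i)) → i ≡ j
≤ᵇ-antisym both = let i≤ᵇj , j≤ᵇi = Equivalence.to T-∧ both in ≤-antisym (≤ᵇ⇒≤ i≤ᵇj) (≤ᵇ⇒≤ j≤ᵇi)

≤ᵇ-antisym-indicator : ∀ i j → (if (i ≤ᵇ j) ∧ (j ≤ᵇ i) then 1ℤ else 0ℤ) ≡ δ (j - i)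
≤ᵇ-antisym-indicator i j with (i ≤ᵇ j) ∧ (j ≤ᵇ i) in both | i ≟ j
... | true  | yes refl = sym (cong δ (+-inverseʳ i))
... | true  | no i≢j  = ⊥-elim (i≢j (≤ᵇ-antisym (subst T (sym both) tt)))
... | false | yes refl = ⊥-elim (subst T both (Equivalence.from T-∧ (≤⇒≤ᵇ (≤-refl {i}) , ≤⇒≤ᵇ (≤-refl {i}))))
... | false | no i≢j  = sym (δ-≢0 (i≢j ∘ sym ∘ i-j≡0⇒i≡j j i))

δ-abs : ∀ s k → δ (+ suc k - + ∣ s ∣) ≡ δ (+ suc k - s) + δ (-[1+ k ] - s)
δ-abs (+ zero)   k = sym (+-identityʳ _)
δ-abs (+ suc _)  k = sym (+-identityʳ _)
δ-abs -[1+ n ]   k = begin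
  δ (suc k ⊖ suc n)        ≡⟨ cong δ (⊖-swap (suc k) (suc n)) ⟩
  δ (- (suc n ⊖ suc k))    ≡⟨ δ-neg (suc n ⊖ suc k) ⟩
  δ (suc n ⊖ suc k)        ≡⟨ +-identityˡ _ ⟨
  0ℤ + δ (suc n ⊖ suc k)   ∎

signedSum : ∀ a {b} → Vec ℤ (a ℕ.+ b) → ℤ
signedSum a xs = vsum (take a xs) - vsum (drop a xs)

signedSum-++ : ∀ {a b} (xs : Vec ℤ a) (ys : Vec ℤ b) → signedSum a (xs ++ ys) ≡ vsum xs - vsum ys
signedSum-++ {a} xs ys with ++-injective xs (take a (xs ++ ys)) (proj₂ (proj₂ (splitAt a (xs ++ ys))))
... | xs≡ , ys≡ = cong₂ (λ u v → vsum u - vsum v) (sym xs≡) (sym ys≡)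

module Box (ℓ : ℤ) (w : ℕ) where

  m : ℤ
  m = ℓ + + w

  width : ∣ m - ℓ + 1ℤ ∣ ≡ suc w
  width = cong ∣_∣ (cancel ℓ (+ w))
    where
    cancel : ∀ ℓ w → ℓ + w - ℓ + 1ℤ ≡ 1ℤ + w
    cancel = solve-∀

  range≡applyUpTo : range ℓ m ≡ applyUpTo (λ j → ℓ + + j) (suc w)
  range≡applyUpTo = begin
    filterᵇ (_≤ᵇ m) (map (λ j → ℓ + + j) (upTo ∣ m - ℓ + 1ℤ ∣))
      ≡⟨ cong (λ n → filterᵇ (_≤ᵇ m) (map (λ j → ℓ + + j) (upTo n))) width ⟩
    filterᵇ (_≤ᵇ m) (map (λ j → ℓ + + j) (upTo (suc w)))
      ≡⟨ cong (filterᵇ (_≤ᵇ m)) (map-upTo (λ j → ℓ + + j) (suc w)) ⟩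
    filterᵇ (_≤ᵇ m) (applyUpTo (λ j → ℓ + + j) (suc w))
      ≡⟨ filter-all (T? ∘ (_≤ᵇ m))
           (applyUpTo⁺₁ (λ j → ℓ + + j) (suc w) λ j≤w → ≤⇒≤ᵇ (+-monoʳ-≤ ℓ (+≤+ (ℕ.s≤s⁻¹ j≤w)))) ⟩
    applyUpTo (λ j → ℓ + + j) (suc w) ∎

  ∑tuples : (n : ℕ) → (Vec ℤ n → ℤ) → ℤ
  ∑tuples n f = sumℤ (map f (tuples ℓ m n))

  ∑tuples-cong : ∀ n {f g : Vec ℤ n → ℤ} → (∀ xs → f xs ≡ g xs) → ∑tuples n f ≡ ∑tuples n g
  ∑tuples-cong n f≗g = cong sumℤ (map-cong f≗g (tuples ℓ m n))

  ∑tuples-suc : ∀ n f → ∑tuples (suc n) f ≡ ∑[ j < suc w ] ∑tuples n (λ ys → f ((ℓ + + j) ∷ ys))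
  ∑tuples-suc n f = begin
    sumℤ (map f (concatMap (λ x → map (x ∷_) (tuples ℓ m n)) (range ℓ m)))
      ≡⟨ sumℤ-map-concatMap f (λ x → map (x ∷_) (tuples ℓ m n)) (range ℓ m) ⟩
    sumℤ (map (λ x → sumℤ (map f (map (x ∷_) (tuples ℓ m n)))) (range ℓ m))
      ≡⟨ cong (λ xs → sumℤ (map (λ x → sumℤ (map f (map (x ∷_) (tuples ℓ m n)))) xs)) range≡applyUpTo ⟩
    sumℤ (map (λ x → sumℤ (map f (map (x ∷_) (tuples ℓ m n)))) (applyUpTo (λ j → ℓ + + j) (suc w)))
      ≡⟨ cong sumℤ (map-applyUpTo (λ j → ℓ + + j) (λ x → sumℤ (map f (map (x ∷_) (tuples ℓ m n)))) (suc w)) ⟩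
    ∑[ j < suc w ] sumℤ (map f (map ((ℓ + + j) ∷_) (tuples ℓ m n)))
      ≡⟨ ∑-cong (suc w) (λ j → cong sumℤ (map-∘ {g = f} {f = (ℓ + + j) ∷_} (tuples ℓ m n))) ⟨
    ∑[ j < suc w ] ∑tuples n (λ ys → f ((ℓ + + j) ∷ ys)) ∎

  solutions : ℕ → ℕ → ℤ → ℤ
  solutions a b t = ∑tuples (a ℕ.+ b) (λ xs → δ (t - signedSum a xs))

  solutions≡boundedCompositions : ∀ a b t →
    solutions a b t ≡ boundedCompositions (suc w) (a ℕ.+ b) (t + + a * (1ℤ - ℓ) + + b * (m + 1ℤ))
  solutions≡boundedCompositions zero zero t = trans (+-identityʳ _) (cong δ (shift t ℓ m))
    where
    shift : ∀ t ℓ m → t - (0ℤ - 0ℤ) ≡ t + 0ℤ * (1ℤ - ℓ) + 0ℤ * (m + 1ℤ)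
    shift = solve-∀
  solutions≡boundedCompositions zero (suc b) t = begin
    solutions 0 (suc b) t
      ≡⟨ ∑tuples-suc b (λ xs → δ (t - signedSum 0 xs)) ⟩
    ∑[ j < suc w ] ∑tuples b (λ ys → δ (t - signedSum 0 ((ℓ + + j) ∷ ys)))
      ≡⟨ ∑-cong (suc w) (λ j → ∑tuples-cong b λ ys → cong δ (peel t (ℓ + + j) (vsum ys))) ⟩
    ∑[ j < suc w ] solutions 0 b (t + (ℓ + + j))
      ≡⟨ ∑-cong (suc w) (λ j → solutions≡boundedCompositions 0 b (t + (ℓ + + j))) ⟩
    ∑[ j < suc w ] f (+ j)
      ≡⟨ ∑-reverse (suc w) f ⟩
    ∑[ j < suc w ] f (+ suc w - 1ℤ - + j)
      ≡⟨ ∑-cong (suc w) (λ j → cong (boundedCompositions (suc w) b) (reindex t ℓ (+ w) (+ b) (+ j))) ⟩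
    boundedCompositions (suc w) (suc b) (t + 0ℤ * (1ℤ - ℓ) + + suc b * (m + 1ℤ)) ∎
    where
    f : ℤ → ℤ
    f x = boundedCompositions (suc w) b (t + (ℓ + x) + 0ℤ * (1ℤ - ℓ) + + b * (m + 1ℤ))
    peel : ∀ t x s → t - (0ℤ - (x + s)) ≡ t + x - (0ℤ - s)
    peel = solve-∀
    reindex : ∀ t ℓ w b j → t + (ℓ + (1ℤ + w - 1ℤ - j)) + 0ℤ * (1ℤ - ℓ) + b * ((ℓ + w) + 1ℤ)
                          ≡ t + 0ℤ * (1ℤ - ℓ) + (1ℤ + b) * ((ℓ + w) + 1ℤ) - (1ℤ + j)
    reindex = solve-∀
  solutions≡boundedCompositions (suc a) b t = begin
    solutions (suc a) b t
      ≡⟨ ∑tuples-suc (a ℕ.+ b) (λ xs → δ (t - signedSum (suc a) xs)) ⟩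
    ∑[ j < suc w ] ∑tuples (a ℕ.+ b) (λ ys → δ (t - signedSum (suc a) ((ℓ + + j) ∷ ys)))
      ≡⟨ ∑-cong (suc w) (λ j → ∑tuples-cong (a ℕ.+ b) λ ys →
           cong δ (peel t (ℓ + + j) (vsum (take a ys)) (vsum (drop a ys)))) ⟩
    ∑[ j < suc w ] solutions a b (t - (ℓ + + j))
      ≡⟨ ∑-cong (suc w) (λ j → trans (solutions≡boundedCompositions a b (t - (ℓ + + j)))
                                      (cong (boundedCompositions (suc w) (a ℕ.+ b)) (reindex t ℓ m (+ a) (+ b) (+ j)))) ⟩
    boundedCompositions (suc w) (suc a ℕ.+ b) (t + + suc a * (1ℤ - ℓ) + + b * (m + 1ℤ)) ∎
    where
    peel : ∀ t x u v → t - (x + u - v) ≡ t - x - (u - v)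
    peel = solve-∀
    reindex : ∀ t ℓ m a b j → t - (ℓ + j) + a * (1ℤ - ℓ) + b * (m + 1ℤ)
                            ≡ t + (1ℤ + a) * (1ℤ - ℓ) + b * (m + 1ℤ) - (1ℤ + j)
    reindex = solve-∀

  count≡τ+τ : ∀ a b k →
    + count ℓ m (suc a) b (+ suc k)
      ≡ τ (suc a ℕ.+ b) (+ suc k + (+ suc a) * (1ℤ - ℓ) + (+ b) * (m + 1ℤ)) (∣ m - ℓ + 1ℤ ∣)
        + τ (suc a ℕ.+ b) (+ suc k + (+ b) * (1ℤ - ℓ) + (+ suc a) * (m + 1ℤ)) (∣ m - ℓ + 1ℤ ∣)
  count≡τ+τ a b k = begin
    + count ℓ m (suc a) b (+ suc k)
      ≡⟨ length-filterᵇ (solvesᵇ (suc a) b (+ suc k)) (tuples ℓ m p) ⟩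
    ∑tuples p (λ xs → if solvesᵇ (suc a) b (+ suc k) xs then 1ℤ else 0ℤ)
      ≡⟨ ∑tuples-cong p (λ xs → trans (≤ᵇ-antisym-indicator (+ ∣ signedSum (suc a) xs ∣) (+ suc k))
                                      (δ-abs (signedSum (suc a) xs) k)) ⟩
    ∑tuples p (λ xs → δ (+ suc k - signedSum (suc a) xs) + δ (-[1+ k ] - signedSum (suc a) xs))
      ≡⟨ sumℤ-map-+ (λ xs → δ (+ suc k - signedSum (suc a) xs)) (λ xs → δ (-[1+ k ] - signedSum (suc a) xs)) (tuples ℓ m p) ⟩
    solutions (suc a) b (+ suc k) + solutions (suc a) b -[1+ k ]
      ≡⟨ cong₂ _+_ (solutions≡boundedCompositions (suc a) b (+ suc k)) (solutions≡boundedCompositions (suc a) b -[1+ k ]) ⟩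
    boundedCompositions (suc w) p K₁ + boundedCompositions (suc w) p K₂′
      ≡⟨ cong (_+_ (boundedCompositions (suc w) p K₁))
              (trans (boundedCompositions-reflect (suc w) p K₂′)
                     (cong (boundedCompositions (suc w) p) (reflect (+ suc a) (+ b) ℓ (+ w) (+ suc k)))) ⟩
    boundedCompositions (suc w) p K₁ + boundedCompositions (suc w) p K₂
      ≡⟨ cong₂ _+_ (τ≡boundedCompositions (a ℕ.+ b) w K₁) (τ≡boundedCompositions (a ℕ.+ b) w K₂) ⟨
    τ p K₁ (suc w) + τ p K₂ (suc w)
      ≡⟨ cong (λ d → τ p K₁ d + τ p K₂ d) width ⟨
    τ p K₁ (∣ m - ℓ + 1ℤ ∣) + τ p K₂ (∣ m - ℓ + 1ℤ ∣) ∎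
    where
    p : ℕ
    p = suc a ℕ.+ b
    K₁ K₂ K₂′ : ℤ
    K₁ = + suc k + (+ suc a) * (1ℤ - ℓ) + (+ b) * (m + 1ℤ)
    K₂ = + suc k + (+ b) * (1ℤ - ℓ) + (+ suc a) * (m + 1ℤ)
    K₂′ = -[1+ k ] + + suc a * (1ℤ - ℓ) + + b * (m + 1ℤ)
    reflect : ∀ a b ℓ w k → (a + b) * ((1ℤ + w) + 1ℤ) - (- k + a * (1ℤ - ℓ) + b * ((ℓ + w) + 1ℤ))
                          ≡ k + b * (1ℤ - ℓ) + a * ((ℓ + w) + 1ℤ)
    reflect = solve-∀

count≡τ+τ : ∀ ℓ m a b k → ℓ ≤ m →
  + count ℓ m (suc a) b (+ suc k)
    ≡ τ (suc a ℕ.+ b) (+ suc k + (+ suc a) * (1ℤ - ℓ) + (+ b) * (m + 1ℤ)) (∣ m - ℓ + 1ℤ ∣)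
      + τ (suc a ℕ.+ b) (+ suc k + (+ b) * (1ℤ - ℓ) + (+ suc a) * (m + 1ℤ)) (∣ m - ℓ + 1ℤ ∣)
count≡τ+τ ℓ m a b k ℓ≤m with i≤j⇒∃[k]j≡i+k ℓ≤m
... | w , refl = Box.count≡τ+τ ℓ w a b k

-- Existence of solutions

InRange : ℤ → ℤ → ℤ → Set
InRange ℓ m x = ℓ ≤ x × x ≤ m

vector-with-sum : ∀ n {ℓ m s} → ℓ ≤ m → + n * ℓ ≤ s → s ≤ + n * m →
  ∃ λ (xs : Vec ℤ n) → All (InRange ℓ m) xs × vsum xs ≡ s
vector-with-sum zero    ℓ≤m 0≤s s≤0 = [] , [] , ≤-antisym 0≤s s≤0
vector-with-sum (suc n) {ℓ} {m} {s} ℓ≤m lo hi with ≤-total (s - + n * m) ℓ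
... | inj₁ s-nm≤ℓ =
  let xs , xs∈ , Σxs≡ = vector-with-sum n ℓ≤m (≤-by-slack lo (rest-lo s ℓ (+ n)))
                                               (≤-by-slack s-nm≤ℓ (rest-hi s ℓ (+ n * m)))
  in ℓ ∷ xs , (≤-refl , ℓ≤m) ∷ xs∈ , trans (cong (_+_ ℓ) Σxs≡) (cancel ℓ s)
  where
  rest-lo : ∀ s ℓ n → s - ℓ - n * ℓ ≡ s - (1ℤ + n) * ℓ
  rest-lo = solve-∀
  rest-hi : ∀ s ℓ x → x - (s - ℓ) ≡ ℓ - (s - x)
  rest-hi = solve-∀
  cancel : ∀ ℓ s → ℓ + (s - ℓ) ≡ s
  cancel = solve-∀
... | inj₂ ℓ≤s-nm =
  let xs , xs∈ , Σxs≡ = vector-with-sum n ℓ≤m (*-monoˡ-≤-nonNeg (+ n) ℓ≤m) ≤-refl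
  in s - + n * m ∷ xs , (ℓ≤s-nm , ≤-by-slack hi (head-hi s m (+ n))) ∷ xs∈ ,
     trans (cong (_+_ (s - + n * m)) Σxs≡) (cancel s (+ n * m))
  where
  head-hi : ∀ s m n → m - (s - n * m) ≡ (1ℤ + n) * m - s
  head-hi = solve-∀
  cancel : ∀ s x → s - x + x ≡ s
  cancel = solve-∀

-- The second block sums to max(b ℓ, a ℓ - k), the first to k more.
vectors-with-difference : ∀ a b {ℓ m k} → ℓ ≤ m → + a * ℓ - + b * m ≤ k → k ≤ + a * m - + b * ℓ →
  ∃₂ λ (xs : Vec ℤ a) (ys : Vec ℤ b) → All (InRange ℓ m) xs × All (InRange ℓ m) ys × vsum xs - vsum ys ≡ k
vectors-with-difference a b {ℓ} {m} {k} ℓ≤m lo hi with ≤-total (+ a * ℓ - k) (+ b * ℓ)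
... | inj₁ aℓ-k≤bℓ =
  let xs , xs∈ , Σxs≡ = vector-with-sum a ℓ≤m (≤-by-slack aℓ-k≤bℓ (lo′ (+ a * ℓ) (+ b * ℓ) k))
                                               (≤-by-slack hi (hi′ (+ a * m) (+ b * ℓ) k))
      ys , ys∈ , Σys≡ = vector-with-sum b ℓ≤m ≤-refl (*-monoˡ-≤-nonNeg (+ b) ℓ≤m)
  in xs , ys , xs∈ , ys∈ , trans (cong₂ _-_ Σxs≡ Σys≡) (cancel (+ b * ℓ) k)
  where
  lo′ : ∀ A B k → B + k - A ≡ B - (A - k)
  lo′ = solve-∀
  hi′ : ∀ A B k → A - (B + k) ≡ A - B - k
  hi′ = solve-∀
  cancel : ∀ B k → B + k - B ≡ k
  cancel = solve-∀
... | inj₂ bℓ≤aℓ-k =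
  let xs , xs∈ , Σxs≡ = vector-with-sum a ℓ≤m ≤-refl (*-monoˡ-≤-nonNeg (+ a) ℓ≤m)
      ys , ys∈ , Σys≡ = vector-with-sum b ℓ≤m bℓ≤aℓ-k (≤-by-slack lo (hi′ (+ a * ℓ) (+ b * m) k))
  in xs , ys , xs∈ , ys∈ , trans (cong₂ _-_ Σxs≡ Σys≡) (cancel (+ a * ℓ) k)
  where
  hi′ : ∀ A B k → B - (A - k) ≡ k - (A - B)
  hi′ = solve-∀
  cancel : ∀ A k → A - (A - k) ≡ k
  cancel = solve-∀

solution-exists : ∀ ℓ m a b k → ℓ ≤ m → 0ℤ ≤ k →
  ((+ a) * ℓ - (+ b) * m ≤ k × k ≤ (+ a) * m - (+ b) * ℓ) ⊎ ((+ b) * ℓ - (+ a) * m ≤ k × k ≤ (+ b) * m - (+ a) * ℓ) →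
  ∃ λ (xs : Vec ℤ (a ℕ.+ b)) → ((i : Fin (a ℕ.+ b)) → InRange ℓ m (lookup xs i)) × + ∣ signedSum a xs ∣ ≡ k
solution-exists ℓ m a b k ℓ≤m 0≤k (inj₁ (lo , hi)) =
  let xs , ys , xs∈ , ys∈ , Σxs-Σys≡k = vectors-with-difference a b ℓ≤m lo hi
  in xs ++ ys , lookup⁺ (++⁺ xs∈ ys∈) , (begin
    + ∣ signedSum a (xs ++ ys) ∣   ≡⟨ cong (+_ ∘ ∣_∣) (trans (signedSum-++ xs ys) Σxs-Σys≡k) ⟩
    + ∣ k ∣                        ≡⟨ 0≤i⇒+∣i∣≡i 0≤k ⟩
    k                              ∎)
solution-exists ℓ m a b k ℓ≤m 0≤k (inj₂ (lo , hi)) =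
  let ys , xs , ys∈ , xs∈ , Σys-Σxs≡k = vectors-with-difference b a ℓ≤m lo hi
  in xs ++ ys , lookup⁺ (++⁺ xs∈ ys∈) , (begin
    + ∣ signedSum a (xs ++ ys) ∣   ≡⟨ cong (+_ ∘ ∣_∣) (signedSum-++ xs ys) ⟩
    + ∣ vsum xs - vsum ys ∣        ≡⟨ cong (+_ ∘ ∣_∣) (antisym (vsum xs) (vsum ys)) ⟩
    + ∣ - (vsum ys - vsum xs) ∣    ≡⟨ cong +_ (∣-i∣≡∣i∣ (vsum ys - vsum xs)) ⟩
    + ∣ vsum ys - vsum xs ∣        ≡⟨ cong (+_ ∘ ∣_∣) Σys-Σxs≡k ⟩
    + ∣ k ∣                        ≡⟨ 0≤i⇒+∣i∣≡i 0≤k ⟩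
    k                              ∎)
  where
  antisym : ∀ x y → x - y ≡ - (y - x)
  antisym = solve-∀

corollary3p3 : (ℓ m : ℤ) (a b : ℕ) (k : ℤ) → ℓ ≤ m → 1 ℕ.≤ a → 1 ℕ.≤ b → 1ℤ ≤ k →
    (+ count ℓ m a b k
      ≡ τ (a ℕ.+ b) (k + (+ a) * (1ℤ - ℓ) + (+ b) * (m + 1ℤ)) (∣ m - ℓ + 1ℤ ∣)
        + τ (a ℕ.+ b) (k + (+ b) * (1ℤ - ℓ) + (+ a) * (m + 1ℤ)) (∣ m - ℓ + 1ℤ ∣))
    × (((+ a) * ℓ - (+ b) * m ≤ k × k ≤ (+ a) * m - (+ b) * ℓ)
        ⊎ ((+ b) * ℓ - (+ a) * m ≤ k × k ≤ (+ b) * m - (+ a) * ℓ)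
      → ∃ λ (xs : Vec ℤ (a ℕ.+ b))
          → ((i : Fin (a ℕ.+ b)) → ℓ ≤ lookup xs i × lookup xs i ≤ m)
            × + ∣ vsum (take a xs) - vsum (drop a xs) ∣ ≡ k)
corollary3p3 ℓ m (suc a) b (+ suc k) ℓ≤m (ℕ.s≤s ℕ.z≤n) _ (+≤+ (ℕ.s≤s ℕ.z≤n)) =
  count≡τ+τ ℓ m a b k ℓ≤m , solution-exists ℓ m (suc a) b (+ suc k) ℓ≤m (+≤+ ℕ.z≤n)
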